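{- Let $M=(X,R_E,R_\Box,v)$ be a finite relational evidence and knowability model. Enumerate the set $Up(X)$ of upsets of the preorder $(X,R_\Box)$ as $E_1,\dots,E_n$ with $E_n=X$, take evidence states $\mathcal{E}=\{e_1,\dots,e_n\}$ (one per upset), order them by $e_i\leq e_j$ iff $E_i\subseteq E_j$, let $\oplus$ be the greatest lower bound operation of $(\mathcal{E},\leq)$, and set $I_{e_i}(x)=E_i\cap R_E(x)$ for all $x\in X$. Then $\mathcal{M}_M=(X,\mathcal{E},\oplus,I,v)$ is an evidence interaction model.
   Context: A finite relational evidence and knowability model is $(X,R_E,R_\Box,v)$ with $X$ a finite nonempty set, $R_E$ a reflexive relation on $X$, $R_\Box$ a reflexive and transitive relation on $X$, and $v:\textsc{prop}\to 2^X$; $R(x)=\{y : xRy\}$. An upset of $(X,R_\Box)$ is a set $S\subseteq X$ such that $x\in S$ and $xR_\Box y$ imply $y\in S$. An evidence interaction model is $(X,\mathcal{E},\oplus,I,v)$ where $(\mathcal{E},\oplus)$ is a meet-semilattice, $X$ nonempty, $I_e:X\to 2^X$ for $e\in\mathcal{E}$, $v$ a valuation, condition (E1) holds ($y\in I_e(x)$ implies $y\in I_e(y)$), and for all $x\in X$ and finite nonempty $\mathcal{E}'\subseteq\mathcal{E}$, $I_{\oplus\mathcal{E}'}(x)=\bigcap_{e\in\mathcal{E}'}I_e(x)$. -}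

module Defs where

open import Level using (0ℓ)
open import Data.Nat using (ℕ)
open import Data.Fin using (Fin)
open import Data.Fin.Subset using (Subset; _∈_; _⊆_; _∩_)
open import Data.Product using (Σ; _×_; proj₁)
open import Data.List.NonEmpty using (List⁺; foldr₁; toList)
import Data.List.Membership.Propositional as LMem
open import Relation.Binary.Core using (Rel)
open import Relation.Binary.PropositionalEquality using (_≡_)
open import Algebra.Core using (Op₂)
open import Algebra.Lattice.Structures using (IsMeetSemilattice)
open import Function.Bundles using (_⇔_)

-- A finite relational evidence and knowability model on X = Fin n.
-- R(x) is represented as the subset R x of X.  Prop is the set of
-- propositional letters.
record RelEKModel (n : ℕ) (Prop : Set) : Set where
  field
    RE       : Fin n → Subset n
    RB       : Fin n → Subset n
    RE-refl  : ∀ x → x ∈ RE x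
    RB-refl  : ∀ x → x ∈ RB x
    RB-trans : ∀ {x y z} → y ∈ RB x → z ∈ RB y → z ∈ RB x
    v        : Prop → Subset n

open RelEKModel public

IsUpset : ∀ {n} → (Fin n → Subset n) → Subset n → Set
IsUpset R S = ∀ {x y} → x ∈ S → y ∈ R x → y ∈ S

-- Evidence states: one per upset of (X, R□)
Upset : ∀ {n Prop} → RelEKModel n Prop → Set
Upset {n} M = Σ (Subset n) (IsUpset (RB M))

_≈ᵁ_ : ∀ {n Prop} {M : RelEKModel n Prop} → Rel (Upset M) 0ℓ
e ≈ᵁ f = proj₁ e ≡ proj₁ f

_≤ᵁ_ : ∀ {n Prop} {M : RelEKModel n Prop} → Rel (Upset M) 0ℓ
e ≤ᵁ f = proj₁ e ⊆ proj₁ f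

IsGLBOp : ∀ {n Prop} (M : RelEKModel n Prop) → Op₂ (Upset M) → Set
IsGLBOp M _⊕_ = ∀ e f →
  ((e ⊕ f) ≤ e) × ((e ⊕ f) ≤ f) × (∀ g → g ≤ e → g ≤ f → g ≤ (e ⊕ f))
  where
  _≤_ = _≤ᵁ_ {M = M}

Iᴹ : ∀ {n Prop} (M : RelEKModel n Prop) → Upset M → Fin n → Subset n
Iᴹ M e x = proj₁ e ∩ RE M x

-- Evidence interaction model (X, ℰ, ⊕, I, v), with X and ℰ types,
-- subsets of X as predicates (I e x y means y ∈ I_e(x)), ≈ the equality
-- on ℰ.  Finite nonempty ℰ' ⊆ ℰ are given as nonempty lists, and
-- ⊕ℰ' is the fold of ⊕ over the list.
record IsEvidenceInteractionModel {X E Prop : Set} (_≈_ : Rel E 0ℓ)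
    (_⊕_ : Op₂ E) (I : E → X → X → Set) (v : Prop → X → Set) : Set where
  field
    nonempty      : X
    meetSemilat   : IsMeetSemilattice _≈_ _⊕_
    E1            : ∀ e x y → I e x y → I e y y
    intersection  : ∀ x (E' : List⁺ E) y →
                    I (foldr₁ _⊕_ E') x y ⇔ (∀ e → e LMem.∈ toList E' → I e x y)

module Submission where

-- The proof rests on one observation: upsets are closed
-- under intersection, so _∩_ is a greatest-lower-bound operation on
-- them, and since ⊆ is antisymmetric EVERY greatest-lower-bound
-- operation ⊕ computes exactly the intersection of the underlying sets.
-- Consequently:
--   * the map e ↦ E_e is an injective magma homomorphism from (ℰ, ⊕) to
--     (Subset, ∩), so the meet-semilattice laws transfer from ∩ to ⊕
--     (via the library's monomorphism-transfer module);
--   * folding ⊕ over a nonempty list of states yields the intersection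
--     of their upsets, which gives the intersection axiom for
--     I_e(x) = E_e ∩ R_E(x);
--   * (E1) holds because R_E is reflexive.

open import Defs
open import Data.Nat using (ℕ; suc)
open import Data.Fin using (Fin)
open import Data.Fin.Subset using (Subset; _∈_; _∩_)
open import Data.Fin.Subset.Properties
  using (⊆-antisym; p∩q⊆p; p∩q⊆q; x∈p∩q⁺; x∈p∩q⁻; ∩-isSemilattice)
open import Data.Product using (Σ; _×_; _,_; proj₁; proj₂)
open import Data.List using ([]; _∷_)
open import Data.List.NonEmpty using (List⁺; _∷_; foldr₁; toList)
open import Data.List.Relation.Unary.Any using (here; there)
import Data.List.Membership.Propositional as LMem
open import Relation.Binary.PropositionalEquality
  using (_≡_; refl; sym; subst)
open import Algebra.Core using (Op₂)
open import Algebra.Lattice.Structures using (IsMeetSemilattice)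
open import Algebra.Morphism.Structures using (IsMagmaMonomorphism)
import Algebra.Morphism.MagmaMonomorphism as Transfer
open import Function.Bundles using (_⇔_; mk⇔; module Equivalence)

∩-isUpset : ∀ {n} {R : Fin n → Subset n} {S T : Subset n} →
            IsUpset R S → IsUpset R T → IsUpset R (S ∩ T)
∩-isUpset {S = S} {T} S-up T-up x∈S∩T xRy =
  let (x∈S , x∈T) = x∈p∩q⁻ S T x∈S∩T
  in x∈p∩q⁺ (S-up x∈S xRy , T-up x∈T xRy)

module _ {n} {A : Set} (⟦_⟧ : A → Subset n) (_⊕_ : Op₂ A)
         (⊕-homo : ∀ a b → ⟦ a ⊕ b ⟧ ≡ ⟦ a ⟧ ∩ ⟦ b ⟧) where

  ∈-foldr₁ : ∀ (as : List⁺ A) y →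
             y ∈ ⟦ foldr₁ _⊕_ as ⟧ ⇔ (∀ a → a LMem.∈ toList as → y ∈ ⟦ a ⟧)
  ∈-foldr₁ (a ∷ as) y = mk⇔ (to a as) (from a as)
    where
    to : ∀ a as → y ∈ ⟦ foldr₁ _⊕_ (a ∷ as) ⟧ →
         ∀ b → b LMem.∈ toList (a ∷ as) → y ∈ ⟦ b ⟧
    to a []       y∈ b (here refl) = y∈
    to a (c ∷ as) y∈ b b∈ with x∈p∩q⁻ ⟦ a ⟧ _ (subst (y ∈_) (⊕-homo a _) y∈) | b∈
    ... | y∈a , _     | here refl    = y∈a
    ... | _ , y∈rest  | there b∈rest = to c as y∈rest b b∈rest

    from : ∀ a as → (∀ b → b LMem.∈ toList (a ∷ as) → y ∈ ⟦ b ⟧) →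
           y ∈ ⟦ foldr₁ _⊕_ (a ∷ as) ⟧
    from a []       all = all a (here refl)
    from a (c ∷ as) all =
      subst (y ∈_) (sym (⊕-homo a (foldr₁ _⊕_ (c ∷ as))))
        (x∈p∩q⁺ (all a (here refl) , from c as (λ b b∈ → all b (there b∈))))

module _ {n : ℕ} {Prop : Set} (M : RelEKModel n Prop) where

  private
    ℰ = Upset M

    ⟦_⟧ : ℰ → Subset n
    ⟦_⟧ = proj₁

  _⊓_ : Op₂ ℰ
  (S , S-up) ⊓ (T , T-up) = S ∩ T , ∩-isUpset S-up T-up

  ⊓-isGLB : IsGLBOp M _⊓_
  ⊓-isGLB (S , _) (T , _) =
    p∩q⊆p S T , p∩q⊆q S T , λ g g⊆S g⊆T y∈g → x∈p∩q⁺ (g⊆S y∈g , g⊆T y∈g)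

  module _ (_⊕_ : Op₂ ℰ) (⊕-isGLB : IsGLBOp M _⊕_) where

    -- Any glb operation agrees with intersection: e ⊕ f ⊆ E_e ∩ E_f since
    -- it is a lower bound, and E_e ∩ E_f ⊆ e ⊕ f since e ⊓ f is one too.
    ⊕-is-∩ : ∀ e f → ⟦ e ⊕ f ⟧ ≡ ⟦ e ⟧ ∩ ⟦ f ⟧
    ⊕-is-∩ e f = ⊆-antisym
      (λ y∈ → x∈p∩q⁺ (⊕≤e y∈ , ⊕≤f y∈))
      (greatest (e ⊓ f) (p∩q⊆p ⟦ e ⟧ ⟦ f ⟧) (p∩q⊆q ⟦ e ⟧ ⟦ f ⟧))
      where
      ⊕≤e = proj₁ (⊕-isGLB e f)
      ⊕≤f = proj₁ (proj₂ (⊕-isGLB e f))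
      greatest = proj₂ (proj₂ (⊕-isGLB e f))

    ⟦⟧-isMagmaMonomorphism :
      IsMagmaMonomorphism (record { _≈_ = _≈ᵁ_ {M = M} ; _∙_ = _⊕_ })
                          (record { _≈_ = _≡_ ; _∙_ = _∩_ }) ⟦_⟧
    ⟦⟧-isMagmaMonomorphism = record
      { isMagmaHomomorphism = record
        { isRelHomomorphism = record { cong = λ e≈f → e≈f }
        ; homo              = ⊕-is-∩
        }
      ; injective = λ ⟦e⟧≡⟦f⟧ → ⟦e⟧≡⟦f⟧
      }

    ⊕-isMeetSemilattice : IsMeetSemilattice (_≈ᵁ_ {M = M}) _⊕_
    ⊕-isMeetSemilattice = record
      { isBand = Transfer.isBand ⟦⟧-isMagmaMonomorphism ∩.isBand
      ; comm   = Transfer.comm ⟦⟧-isMagmaMonomorphism ∩.isMagma ∩.comm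
      }
      where module ∩ = IsMeetSemilattice _≡_ (∩-isSemilattice n)

    -- Intersection axiom for I_e(x) = E_e ∩ R_E(x): the constant factor
    -- R_E(x) commutes with the (nonempty) intersection over the list.
    I-intersection : ∀ x (es : List⁺ ℰ) y →
      y ∈ Iᴹ M (foldr₁ _⊕_ es) x ⇔ (∀ e → e LMem.∈ toList es → y ∈ Iᴹ M e x)
    I-intersection x es@(e₀ ∷ _) y = mk⇔
      (λ y∈I e e∈ → let (y∈fold , y∈RE) = x∈p∩q⁻ _ _ y∈I
                     in x∈p∩q⁺ (to y∈fold e e∈ , y∈RE))
      (λ all → x∈p∩q⁺ ( from (λ e e∈ → proj₁ (x∈p∩q⁻ ⟦ e ⟧ _ (all e e∈)))
                      , proj₂ (x∈p∩q⁻ ⟦ e₀ ⟧ _ (all e₀ (here refl)))))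
      where open Equivalence (∈-foldr₁ ⟦_⟧ _⊕_ ⊕-is-∩ es y) using (to; from)

  -- (E1): y ∈ I_e(x) gives y ∈ E_e, and y ∈ R_E(y) by reflexivity.
  I-E1 : ∀ e x y → y ∈ Iᴹ M e x → y ∈ Iᴹ M e y
  I-E1 e x y y∈I = x∈p∩q⁺ (proj₁ (x∈p∩q⁻ ⟦ e ⟧ _ y∈I) , RE-refl M y)

lemma4 : ∀ {m : ℕ} {Prop : Set} (M : RelEKModel (suc m) Prop) →
    Σ (Op₂ (Upset M)) (IsGLBOp M)
    × (∀ (_⊕_ : Op₂ (Upset M)) → IsGLBOp M _⊕_ →
         IsEvidenceInteractionModel (_≈ᵁ_ {M = M}) _⊕_
           (λ e x y → y ∈ Iᴹ M e x) (λ p x → x ∈ v M p))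
lemma4 M = (_⊓_ M , ⊓-isGLB M) , λ _⊕_ ⊕-isGLB → record
  { nonempty     = Fin.zero
  ; meetSemilat  = ⊕-isMeetSemilattice M _⊕_ ⊕-isGLB
  ; E1           = I-E1 M
  ; intersection = I-intersection M _⊕_ ⊕-isGLB
  }
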